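{- Let $b \neq 3$ be a nonzero integer such that $-b$ is not a perfect square and $b$ has a prime divisor $p$ with $p \equiv 3$ or $5 \pmod 8$. A pair $(X, Y)$ with $X, Y \in M_2(\mathbb{Z})$ satisfies $X^2 + bY^2 = 2I$ if and only if one of the following holds: (i) $X = \begin{pmatrix} t_1 & t_2 \\ t_3 & -t_1 \end{pmatrix}$, $Y = \begin{pmatrix} s_1 & s_2 \\ s_3 & -s_1 \end{pmatrix}$ with $t_1, t_2, t_3, s_1, s_2, s_3 \in \mathbb{Z}$ and $t_1^2 + t_2 t_3 + b(s_1^2 + s_2 s_3) = 2$; (ii) if $b > 0$: $X = \begin{pmatrix} t_1 & t_2 \\ t_3 & -t_1 \end{pmatrix}$, $Y = t_4 I$ with $t_1, t_2, t_3, t_4 \in \mathbb{Z}$ and $t_1^2 + t_2 t_3 + b t_4^2 = 2$; if $b < 0$: $X = \begin{pmatrix} t_1 & \frac{u-2}{g} t_2 \\ \frac{u-2}{g} t_3 & \frac{u t_1 + vb t_4}{2} \end{pmatrix}$, $Y = \begin{pmatrix} t_4 & \frac{v}{g} t_2 \\ \frac{v}{g} t_3 & \frac{v t_1 - u t_4}{2} \end{pmatrix}$, where $t_1, t_2, t_3, t_4, u, v \in \mathbb{Z}$, $u \neq 2$, $g = \gcd(v, u-2)$, and $$u^2 + v^2 b = 4, \qquad t_1^2 + b t_4^2 + \frac{4 t_2 t_3}{g^2}(2 - u) = 2.$$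
   Context: $M_2(\mathbb{Z})$ denotes the ring of $2\times 2$ matrices with integer entries; $I$ is the $2\times 2$ identity matrix. -}

module Defs where

open import Data.Integer using (ℤ; +_; _+_; _*_; -_; _-_; ∣_∣; _<_; _>_)
open import Data.Integer.GCD using (gcd)
open import Data.Nat using (ℕ; _%_)
open import Data.Nat.Primality using (Prime)
import Data.Nat.Divisibility as ℕ
open import Data.Product using (Σ; _×_; ∃; _,_)
open import Data.Sum using (_⊎_)
open import Relation.Binary.PropositionalEquality using (_≡_; _≢_)
open import Relation.Nullary using (¬_)

record M₂ : Set where
  constructor mat
  field
    a₁₁ a₁₂ a₂₁ a₂₂ : ℤ
open M₂ public

infixl 6 _⊕_
infixl 7 _⊗_
infixr 8 _·_

_⊕_ : M₂ → M₂ → M₂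
mat a b c d ⊕ mat a' b' c' d' = mat (a + a') (b + b') (c + c') (d + d')

_⊗_ : M₂ → M₂ → M₂
mat a b c d ⊗ mat a' b' c' d' =
  mat (a * a' + b * c') (a * b' + b * d') (c * a' + d * c') (c * b' + d * d')

_·_ : ℤ → M₂ → M₂
k · mat a b c d = mat (k * a) (k * b) (k * c) (k * d)

I : M₂
I = mat (+ 1) (+ 0) (+ 0) (+ 1)

sq : M₂ → M₂
sq X = X ⊗ X

IsPerfectSquare : ℤ → Set
IsPerfectSquare n = ∃ λ (k : ℤ) → k * k ≡ n

HasPrimeDivisor3or5mod8 : ℤ → Set
HasPrimeDivisor3or5mod8 b =
  Σ ℕ λ p → Prime p × (p ℕ.∣ ∣ b ∣) × ((p % 8 ≡ 3) ⊎ (p % 8 ≡ 5))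

CaseI : ℤ → M₂ → M₂ → Set
CaseI b X Y = Σ ℤ λ t₁ → Σ ℤ λ t₂ → Σ ℤ λ t₃ → Σ ℤ λ s₁ → Σ ℤ λ s₂ → Σ ℤ λ s₃ →
  (X ≡ mat t₁ t₂ t₃ (- t₁)) × (Y ≡ mat s₁ s₂ s₃ (- s₁)) ×
  (t₁ * t₁ + t₂ * t₃ + b * (s₁ * s₁ + s₂ * s₃) ≡ + 2)

CaseIIpos : ℤ → M₂ → M₂ → Set
CaseIIpos b X Y = Σ ℤ λ t₁ → Σ ℤ λ t₂ → Σ ℤ λ t₃ → Σ ℤ λ t₄ →
  (X ≡ mat t₁ t₂ t₃ (- t₁)) × (Y ≡ t₄ · I) ×
  (t₁ * t₁ + t₂ * t₃ + b * (t₄ * t₄) ≡ + 2)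

-- (ii), b < 0: with g = gcd(v, u-2), u ≠ 2 (so g ≠ 0),
--   X = (t1, (u-2)/g t2; (u-2)/g t3, (u t1 + v b t4)/2)
--   Y = (t4, v/g t2;     v/g t3,     (v t1 - u t4)/2)
-- The entries of X, Y are integers (X, Y ∈ M₂(ℤ)); each rational-valued
-- formula "entry = N / D" is written as the equivalent "D * entry = N"
-- (D ≠ 0).  Likewise the condition
--   t1² + b t4² + 4 t2 t3 (2-u) / g² = 2
-- is multiplied through by g² ≠ 0.
CaseIIneg : ℤ → M₂ → M₂ → Set
CaseIIneg b X Y = Σ ℤ λ t₁ → Σ ℤ λ t₂ → Σ ℤ λ t₃ → Σ ℤ λ t₄ → Σ ℤ λ u → Σ ℤ λ v →
  let g = gcd v (u - + 2) in
  (u ≢ + 2) ×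
  (u * u + v * v * b ≡ + 4) ×
  (g * g * (t₁ * t₁ + b * (t₄ * t₄)) + + 4 * t₂ * t₃ * (+ 2 - u) ≡ + 2 * (g * g)) ×
  (a₁₁ X ≡ t₁) ×
  (g * a₁₂ X ≡ (u - + 2) * t₂) ×
  (g * a₂₁ X ≡ (u - + 2) * t₃) ×
  (+ 2 * a₂₂ X ≡ u * t₁ + v * b * t₄) ×
  (a₁₁ Y ≡ t₄) ×
  (g * a₁₂ Y ≡ v * t₂) ×
  (g * a₂₁ Y ≡ v * t₃) ×
  (+ 2 * a₂₂ Y ≡ v * t₁ - u * t₄)

CaseII : ℤ → M₂ → M₂ → Set
CaseII b X Y = ((b > + 0) × CaseIIpos b X Y) ⊎ ((b < + 0) × CaseIIneg b X Y)

-- Let T = tr X and S = tr Y.  By Cayley–Hamilton the equation says that T X + b S Y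
-- is a scalar matrix.  If S = 0 then T X is scalar, so x₁₂ = 0 when T ≠ 0, and the
-- (1,1) entry gives x₁₁² + b k = 2; this is impossible because 2 is not a square
-- modulo a prime p ≡ ±3 (mod 8).  Hence S = 0 forces T = 0, which is case (i).
-- If S ≠ 0 then X and Y commute.  Put Z = X + ωY and Z̄ = X − ωY with ω² = −b, so
-- that Z Z̄ = X² + bY² = 2I.  Writing det Z = u + ωv, this gives u² + bv² = 4 and
-- det Z · Z̄ = 2 adj Z, i.e. linear relations between the entries of X, Y and u, v.
-- For b > 0 these force v = 0 (since b ≥ 5) and u = −2, and then Y is scalar.
-- For b < 0 one has u ≠ 2, and a Bézout combination of v and u − 2 produces the
-- parameters t₂, t₃ of case (ii).

module Submission where

open import Defs
open import Data.Nat as ℕ using (suc)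
import Data.Nat.Properties as ℕ
open import Data.List using (List; _∷_; [])
open import Data.Product using (∃₂; _×_; _,_; proj₁; proj₂)
open import Data.Sum using (_⊎_; inj₁; inj₂; [_,_]′; reduce)
open import Function using (_∘_)
open import Function.Bundles using (_⇔_; mk⇔)
open import Relation.Binary.Definitions using (tri<; tri≈; tri>)
open import Relation.Binary.PropositionalEquality
open import Relation.Nullary using (¬_; contradiction; yes; no)

module SquaresMod8 where
  open import Data.Nat
  open import Data.Nat.Properties
  open import Data.Nat.DivMod
  open import Data.Nat.Divisibility using (_∣_; _∣?_; divides; ∣⇒≤)
  open import Data.Nat.Induction using (<-rec)
  open import Data.Nat.Tactic.RingSolver using (solve-∀)
  open import Relation.Nullary.Decidable using (from-no)
  open ≡-Reasoning

  _≡±1-mod-8 : ℕ → Set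
  n ≡±1-mod-8 = n % 8 ≡ 1 ⊎ n % 8 ≡ 7

  _≡±3-mod-8 : ℕ → Set
  n ≡±3-mod-8 = n % 8 ≡ 3 ⊎ n % 8 ≡ 5

  2-IsSquareMod : ℕ → Set
  2-IsSquareMod n = ∃₂ λ x k → x * x ≡ 2 + k * n

  ≡±1-mod-8⇒≢±3-mod-8 : ∀ {n} → n ≡±1-mod-8 → ¬ n ≡±3-mod-8
  ≡±1-mod-8⇒≢±3-mod-8 (inj₁ p) (inj₁ q) with () ← trans (sym p) q
  ≡±1-mod-8⇒≢±3-mod-8 (inj₁ p) (inj₂ q) with () ← trans (sym p) q
  ≡±1-mod-8⇒≢±3-mod-8 (inj₂ p) (inj₁ q) with () ← trans (sym p) q
  ≡±1-mod-8⇒≢±3-mod-8 (inj₂ p) (inj₂ q) with () ← trans (sym p) q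

  ≡±3-mod-8⇒3≤ : ∀ {n} → n ≡±3-mod-8 → 3 ≤ n
  ≡±3-mod-8⇒3≤ {n} (inj₁ n≡3) = subst (_≤ n) n≡3 (m%n≤m n 8)
  ≡±3-mod-8⇒3≤ {n} (inj₂ n≡5) = ≤-trans (s≤s (s≤s (s≤s z≤n))) (subst (_≤ n) n≡5 (m%n≤m n 8))

  %2≡%8%2 : ∀ n → n % 2 ≡ n % 8 % 2
  %2≡%8%2 n = sym (m∣n⇒o%n%m≡o%m 2 8 n (divides 4 refl))

  ≡±3-mod-8⇒odd : ∀ {n} → n ≡±3-mod-8 → n % 2 ≡ 1
  ≡±3-mod-8⇒odd {n} (inj₁ n≡3) = trans (%2≡%8%2 n) (cong (_% 2) n≡3)
  ≡±3-mod-8⇒odd {n} (inj₂ n≡5) = trans (%2≡%8%2 n) (cong (_% 2) n≡5)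

  even-or-odd : ∀ n → n % 2 ≡ 0 ⊎ n % 2 ≡ 1
  even-or-odd n with n % 2 | m%n<n n 2
  ... | 0 | _ = inj₁ refl
  ... | 1 | _ = inj₂ refl
  ... | suc (suc _) | s≤s (s≤s ())

  *-odd : ∀ m n → n % 2 ≡ 1 → m * n % 2 ≡ m % 2
  *-odd m n n-odd = begin
    m * n % 2               ≡⟨ %-distribˡ-* m n 2 ⟩
    (m % 2) * (n % 2) % 2   ≡⟨ cong (λ r → (m % 2) * r % 2) n-odd ⟩
    (m % 2) * 1 % 2         ≡⟨ cong (_% 2) (*-identityʳ (m % 2)) ⟩
    m % 2 % 2               ≡⟨ m%n%n≡m%n m 2 ⟩
    m % 2                   ∎

  +-even : ∀ m n → n % 2 ≡ 0 → (m + n) % 2 ≡ m % 2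
  +-even m n n-even = begin
    (m + n) % 2             ≡⟨ %-distribˡ-+ m n 2 ⟩
    (m % 2 + n % 2) % 2     ≡⟨ cong (λ r → (m % 2 + r) % 2) n-even ⟩
    (m % 2 + 0) % 2         ≡⟨ cong (_% 2) (+-identityʳ (m % 2)) ⟩
    m % 2 % 2               ≡⟨ m%n%n≡m%n m 2 ⟩
    m % 2                   ∎

  odd-square≡1-mod-8 : ∀ y → y % 2 ≡ 1 → y * y % 8 ≡ 1
  odd-square≡1-mod-8 y y-odd =
    trans (%-distribˡ-* y y 8) (residues (y % 8) (m%n<n y 8) (trans (sym (%2≡%8%2 y)) y-odd))
    where
    residues : ∀ r → r < 8 → r % 2 ≡ 1 → r * r % 8 ≡ 1
    residues 1 _ _ = refl
    residues 3 _ _ = refl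
    residues 5 _ _ = refl
    residues 7 _ _ = refl
    residues 0 _ ()
    residues 2 _ ()
    residues 4 _ ()
    residues 6 _ ()
    residues (suc (suc (suc (suc (suc (suc (suc (suc _)))))))) (s≤s (s≤s (s≤s (s≤s (s≤s (s≤s (s≤s (s≤s ())))))))) _

  ±1-mod-8-cofactor : ∀ m n → m ≡±1-mod-8 → (2 + m * n) % 8 ≡ 1 → n ≡±1-mod-8
  ±1-mod-8-cofactor m n m≡±1 eq = residues (m % 8) (n % 8) m≡±1 (m%n<n n 8) (begin
    (2 + (m % 8) * (n % 8) % 8) % 8  ≡⟨ cong (λ r → (2 + r) % 8) (%-distribˡ-* m n 8) ⟨
    (2 % 8 + m * n % 8) % 8          ≡⟨ %-distribˡ-+ 2 (m * n) 8 ⟨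
    (2 + m * n) % 8                  ≡⟨ eq ⟩
    1                                ∎)
    where
    residues : ∀ c a → c ≡ 1 ⊎ c ≡ 7 → a < 8 → (2 + c * a % 8) % 8 ≡ 1 → a ≡ 1 ⊎ a ≡ 7
    residues .1 7 (inj₁ refl) _ _ = inj₂ refl
    residues .7 1 (inj₂ refl) _ _ = inj₁ refl
    residues .1 0 (inj₁ refl) _ ()
    residues .1 1 (inj₁ refl) _ ()
    residues .1 2 (inj₁ refl) _ ()
    residues .1 3 (inj₁ refl) _ ()
    residues .1 4 (inj₁ refl) _ ()
    residues .1 5 (inj₁ refl) _ ()
    residues .1 6 (inj₁ refl) _ ()
    residues .7 0 (inj₂ refl) _ ()
    residues .7 2 (inj₂ refl) _ ()
    residues .7 3 (inj₂ refl) _ ()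
    residues .7 4 (inj₂ refl) _ ()
    residues .7 5 (inj₂ refl) _ ()
    residues .7 6 (inj₂ refl) _ ()
    residues .7 7 (inj₂ refl) _ ()
    residues _ (suc (suc (suc (suc (suc (suc (suc (suc _)))))))) _ (s≤s (s≤s (s≤s (s≤s (s≤s (s≤s (s≤s (s≤s ())))))))) _

  -- Replacing r by n ∸ r keeps r² mod n and, as n is odd, flips the parity of r.
  odd-square-root-mod : ∀ n .{{_ : NonZero n}} → n % 2 ≡ 1 → 2 < n →
    ∀ r → r < n → r * r % n ≡ 2 → ∃₂ λ y (_ : y % 2 ≡ 1) → y < n × y * y % n ≡ 2
  odd-square-root-mod n n-odd 2<n r r<n r²≡2 with even-or-odd r
  ... | inj₂ r-odd = r , r-odd , r<n , r²≡2
  odd-square-root-mod n n-odd 2<n zero _ 0≡2 | inj₁ _ with () ← trans (sym (m<n⇒m%n≡m (<-trans z<s 2<n))) 0≡2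
  odd-square-root-mod n n-odd 2<n r@(suc _) r<n r²≡2 | inj₁ r-even = s , s-odd , s<n , s²≡2
    where
    s : ℕ
    s = n ∸ r
    s+r≡n : s + r ≡ n
    s+r≡n = m∸n+n≡m (<⇒≤ r<n)
    s<n : s < n
    s<n = ∸-monoʳ-< {o = 0} z<s (<⇒≤ r<n)
    s-odd : s % 2 ≡ 1
    s-odd = trans (sym (+-even s r r-even)) (trans (cong (_% 2) s+r≡n) n-odd)
    swap : ∀ s r → s * s + r * (s + r) ≡ r * r + s * (s + r)
    swap = solve-∀
    s²≡2 : s * s % n ≡ 2
    s²≡2 = begin
      s * s % n                ≡⟨ [m+kn]%n≡m%n (s * s) r n ⟨
      (s * s + r * n) % n      ≡⟨ cong (λ t → (s * s + r * t) % n) s+r≡n ⟨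
      (s * s + r * (s + r)) % n ≡⟨ cong (_% n) (swap s r) ⟩
      (r * r + s * (s + r)) % n ≡⟨ cong (λ t → (r * r + s * t) % n) s+r≡n ⟩
      (r * r + s * n) % n      ≡⟨ [m+kn]%n≡m%n (r * r) s n ⟩
      r * r % n                ≡⟨ r²≡2 ⟩
      2                        ∎

  -- Descent: an odd root y < n of 2 gives y² = 2 + m n with m odd and m < n, and
  -- since y² ≡ 1 (mod 8), m ≡ ±1 (mod 8) forces n ≡ ±1 (mod 8).
  2-IsSquareMod⇒≡±1-mod-8 : ∀ n → n % 2 ≡ 1 → 2-IsSquareMod n → n ≡±1-mod-8
  2-IsSquareMod⇒≡±1-mod-8 = <-rec _ descent
    where
    descent : ∀ n → (∀ {m} → m < n → m % 2 ≡ 1 → 2-IsSquareMod m → m ≡±1-mod-8) →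
              n % 2 ≡ 1 → 2-IsSquareMod n → n ≡±1-mod-8
    descent 1 _ _ _ = inj₁ refl
    descent n@(suc (suc (suc _))) ih n-odd (x , k , x²≡2+kn)
      with y , y-odd , y<n , y²≡2 ← odd-square-root-mod n n-odd (s≤s (s≤s (s≤s z≤n))) (x % n) (m%n<n x n) (begin
        (x % n) * (x % n) % n  ≡⟨ %-distribˡ-* x x n ⟨
        x * x % n              ≡⟨ cong (_% n) x²≡2+kn ⟩
        (2 + k * n) % n        ≡⟨ [m+kn]%n≡m%n 2 k n ⟩
        2                      ∎)
      = ±1-mod-8-cofactor m n (ih m<n m-odd (y , n , y²≡2+nm)) (begin
          (2 + m * n) % 8      ≡⟨ cong (_% 8) y²≡2+mn ⟨
          y * y % 8            ≡⟨ odd-square≡1-mod-8 y y-odd ⟩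
          1                    ∎)
      where
      m : ℕ
      m = y * y / n
      y²≡2+mn : y * y ≡ 2 + m * n
      y²≡2+mn = trans (m≡m%n+[m/n]*n (y * y) n) (cong (_+ m * n) y²≡2)
      y²≡2+nm : y * y ≡ 2 + n * m
      y²≡2+nm = trans y²≡2+mn (cong (2 +_) (*-comm m n))
      m<n : m < n
      m<n = m<n*o⇒m/o<n (*-mono-< y<n y<n)
      m-odd : m % 2 ≡ 1
      m-odd = begin
        m % 2             ≡⟨ *-odd m n n-odd ⟨
        m * n % 2         ≡⟨ [m+kn]%n≡m%n (m * n) 1 2 ⟨
        (m * n + 2) % 2   ≡⟨ cong (_% 2) (trans (+-comm (m * n) 2) (sym y²≡2+mn)) ⟩
        y * y % 2         ≡⟨ *-odd y y y-odd ⟩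
        y % 2             ≡⟨ y-odd ⟩
        1                 ∎

  ≡±3-mod-8⇒∤4 : ∀ {p} → p ≡±3-mod-8 → ¬ p ∣ 4
  ≡±3-mod-8⇒∤4 {0} (inj₁ ())
  ≡±3-mod-8⇒∤4 {0} (inj₂ ())
  ≡±3-mod-8⇒∤4 {1} (inj₁ ())
  ≡±3-mod-8⇒∤4 {1} (inj₂ ())
  ≡±3-mod-8⇒∤4 {2} (inj₁ ())
  ≡±3-mod-8⇒∤4 {2} (inj₂ ())
  ≡±3-mod-8⇒∤4 {3} _ = from-no (3 ∣? 4)
  ≡±3-mod-8⇒∤4 {4} (inj₁ ())
  ≡±3-mod-8⇒∤4 {4} (inj₂ ())
  ≡±3-mod-8⇒∤4 {suc (suc (suc (suc (suc _))))} _ p∣4 = <⇒≱ (s≤s (s≤s (s≤s (s≤s (s≤s z≤n))))) (∣⇒≤ p∣4)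

  ≡±3-mod-8-divisor⇒5≤ : ∀ {p} n → p ≡±3-mod-8 → p ∣ suc n → suc n ≢ 3 → 5 ≤ suc n
  ≡±3-mod-8-divisor⇒5≤ 0 p≡±3 p∣1 _ = contradiction (≤-trans (≡±3-mod-8⇒3≤ p≡±3) (∣⇒≤ p∣1)) λ { (s≤s ()) }
  ≡±3-mod-8-divisor⇒5≤ 1 p≡±3 p∣2 _ = contradiction (≤-trans (≡±3-mod-8⇒3≤ p≡±3) (∣⇒≤ p∣2)) λ { (s≤s (s≤s ())) }
  ≡±3-mod-8-divisor⇒5≤ 2 _ _ 3≢3 = contradiction refl 3≢3
  ≡±3-mod-8-divisor⇒5≤ 3 p≡±3 p∣4 _ = contradiction p∣4 (≡±3-mod-8⇒∤4 p≡±3)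
  ≡±3-mod-8-divisor⇒5≤ (suc (suc (suc (suc _)))) _ _ _ = s≤s (s≤s (s≤s (s≤s (s≤s z≤n))))

open SquaresMod8

open import Data.Integer
  using (ℤ; +_; -[1+_]; +[1+_]; _+_; _*_; -_; _-_; ∣_∣; _>_; +<+; _≟_; NonZero; ≢-nonZero)
open import Data.Integer.Properties
  using (+-injective; pos-+; pos-*; neg-involutive; -1*i≡-i; *-identityˡ; *-identityʳ; *-comm; +-comm;
         *-cancelˡ-≡; *-cancelʳ-≡; *-zeroʳ; i*j≢0; i*j≡0⇒i≡0∨j≡0; i-j≡0⇒i≡j; ∣i∣≡0⇒i≡0; <-cmp)
open import Data.Integer.Divisibility.Signed using (divides; ∣ᵤ⇒∣)
open import Data.Integer.GCD using (gcd; gcd[i,j]≡0⇒j≡0)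
open import Data.Integer.Tactic.RingSolver using (solve; solve-∀)
open import Data.Nat.GCD using (module Bézout; gcd-GCD)

x*x≡+∣x∣*∣x∣ : ∀ x → x * x ≡ + (∣ x ∣ ℕ.* ∣ x ∣)
x*x≡+∣x∣*∣x∣ (+ n)    = sym (pos-* n n)
x*x≡+∣x∣*∣x∣ -[1+ n ] = sym (pos-* (suc n) (suc n))

-- For k ≤ 0 this makes 2 a square modulo n; for k > 0 the left side exceeds 2 as n ≥ 3.
x²+nk≢2 : ∀ {n} → n ≡±3-mod-8 → ∀ x k → x * x + + n * k ≢ + 2
x²+nk≢2 {n} n≡±3 x k x²+nk≡2 with - k in -k≡
... | + j = ≡±1-mod-8⇒≢±3-mod-8 {n}
  (2-IsSquareMod⇒≡±1-mod-8 n (≡±3-mod-8⇒odd {n} n≡±3) (∣ x ∣ , j , +-injective x²≡2+jn)) n≡±3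
  where
  open ≡-Reasoning
  shift : ∀ a c k → a ≡ (a + c * k) + c * - k
  shift = solve-∀
  x²≡2+jn : + (∣ x ∣ ℕ.* ∣ x ∣) ≡ + (2 ℕ.+ j ℕ.* n)
  x²≡2+jn = begin
    + (∣ x ∣ ℕ.* ∣ x ∣)             ≡⟨ x*x≡+∣x∣*∣x∣ x ⟨
    x * x                          ≡⟨ shift (x * x) (+ n) k ⟩
    (x * x + + n * k) + + n * - k  ≡⟨ cong₂ (λ s t → s + + n * t) x²+nk≡2 -k≡ ⟩
    + 2 + + n * + j                ≡⟨ cong (_+_ (+ 2)) (pos-* n j) ⟨
    + (2 ℕ.+ n ℕ.* j)              ≡⟨ cong (λ t → + (2 ℕ.+ t)) (ℕ.*-comm n j) ⟩
    + (2 ℕ.+ j ℕ.* n)              ∎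
... | -[1+ w ] = ℕ.<⇒≱ (ℕ.s≤s (ℕ.s≤s (ℕ.s≤s ℕ.z≤n)))
  (ℕ.≤-trans (≡±3-mod-8⇒3≤ {n} n≡±3) (ℕ.≤-trans (ℕ.m≤m*n n (suc w))
    (ℕ.≤-trans (ℕ.m≤n+m _ (∣ x ∣ ℕ.* ∣ x ∣)) (ℕ.≤-reflexive (+-injective x²+n[1+w]≡2)))))
  where
  open ≡-Reasoning
  x²+n[1+w]≡2 : + (∣ x ∣ ℕ.* ∣ x ∣ ℕ.+ n ℕ.* suc w) ≡ + 2
  x²+n[1+w]≡2 = begin
    + (∣ x ∣ ℕ.* ∣ x ∣ ℕ.+ n ℕ.* suc w)    ≡⟨ pos-+ (∣ x ∣ ℕ.* ∣ x ∣) (n ℕ.* suc w) ⟩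
    + (∣ x ∣ ℕ.* ∣ x ∣) + + (n ℕ.* suc w)  ≡⟨ cong₂ _+_ (x*x≡+∣x∣*∣x∣ x) (sym (pos-* n (suc w))) ⟨
    x * x + + n * +[1+ w ]               ≡⟨ cong (λ t → x * x + + n * t) (trans (sym (neg-involutive k)) (cong -_ -k≡)) ⟨
    x * x + + n * k                      ≡⟨ x²+nk≡2 ⟩
    + 2                                  ∎

x²+bk≢2 : ∀ {b} → HasPrimeDivisor3or5mod8 b → ∀ x k → x * x + b * k ≢ + 2
x²+bk≢2 {b} (p , _ , p∣b , p≡±3) x k x²+bk≡2 with divides q b≡qp ← ∣ᵤ⇒∣ {+ p} {b} p∣b =
  x²+nk≢2 {p} p≡±3 x (q * k) (begin
    x * x + + p * (q * k)   ≡⟨ cong (_+_ (x * x)) (regroup q (+ p) k) ⟩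
    x * x + q * + p * k     ≡⟨ cong (λ c → x * x + c * k) b≡qp ⟨
    x * x + b * k           ≡⟨ x²+bk≡2 ⟩
    + 2                     ∎)
  where
  open ≡-Reasoning
  regroup : ∀ q p k → p * (q * k) ≡ q * p * k
  regroup = solve-∀

u²+v²n≡4⇒v≡0 : ∀ {n} → 5 ℕ.≤ n → ∀ u v → u * u + v * v * + n ≡ + 4 → v ≡ + 0
u²+v²n≡4⇒v≡0 {n} 5≤n u v eq with v ≟ + 0
... | yes v≡0 = v≡0
... | no v≢0  = contradiction (ℕ.≤-trans 5≤n (ℕ.≤-trans (ℕ.m≤n*m n (∣ v ∣ ℕ.* ∣ v ∣) {{v²≢0}})
                  (ℕ.≤-trans (ℕ.m≤n+m _ (∣ u ∣ ℕ.* ∣ u ∣)) (ℕ.≤-reflexive (+-injective u²+v²n≡4)))))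
                  λ { (ℕ.s≤s (ℕ.s≤s (ℕ.s≤s (ℕ.s≤s ())))) }
  where
  open ≡-Reasoning
  v²≢0 : ℕ.NonZero (∣ v ∣ ℕ.* ∣ v ∣)
  v²≢0 = ℕ.m*n≢0 ∣ v ∣ ∣ v ∣ {{ℕ.≢-nonZero (v≢0 ∘ ∣i∣≡0⇒i≡0)}} {{ℕ.≢-nonZero (v≢0 ∘ ∣i∣≡0⇒i≡0)}}
  u²+v²n≡4 : + (∣ u ∣ ℕ.* ∣ u ∣ ℕ.+ ∣ v ∣ ℕ.* ∣ v ∣ ℕ.* n) ≡ + 4
  u²+v²n≡4 = begin
    + (∣ u ∣ ℕ.* ∣ u ∣ ℕ.+ ∣ v ∣ ℕ.* ∣ v ∣ ℕ.* n)        ≡⟨ pos-+ (∣ u ∣ ℕ.* ∣ u ∣) _ ⟩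
    + (∣ u ∣ ℕ.* ∣ u ∣) + + (∣ v ∣ ℕ.* ∣ v ∣ ℕ.* n)      ≡⟨ cong (_+_ (+ (∣ u ∣ ℕ.* ∣ u ∣))) (pos-* (∣ v ∣ ℕ.* ∣ v ∣) n) ⟩
    + (∣ u ∣ ℕ.* ∣ u ∣) + + (∣ v ∣ ℕ.* ∣ v ∣) * + n      ≡⟨ cong₂ (λ p q → p + q * + n) (x*x≡+∣x∣*∣x∣ u) (x*x≡+∣x∣*∣x∣ v) ⟨
    u * u + v * v * + n                                ≡⟨ eq ⟩
    + 4                                                ∎

u²+v²b≡4⇒v≡0 : ∀ {b} → b > + 0 → b ≢ + 3 → HasPrimeDivisor3or5mod8 b →
  ∀ u v → u * u + v * v * b ≡ + 4 → v ≡ + 0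
u²+v²b≡4⇒v≡0 {+[1+ m ]} _ b≢3 (_ , _ , p∣b , p≡±3) =
  u²+v²n≡4⇒v≡0 (≡±3-mod-8-divisor⇒5≤ m p≡±3 p∣b (b≢3 ∘ cong (+_)))
u²+v²b≡4⇒v≡0 {+ 0} (+<+ ())

u*u≡4⇒u≡±2 : ∀ u → u * u ≡ + 4 → u ≡ + 2 ⊎ u ≡ - + 2
u*u≡4⇒u≡±2 u u²≡4 with i*j≡0⇒i≡0∨j≡0 (u - + 2) [u-2][u+2]≡0
  where
  [u-2][u+2]≡0 : (u - + 2) * (u + + 2) ≡ + 0
  [u-2][u+2]≡0 = begin
    (u - + 2) * (u + + 2)  ≡⟨ solve (u ∷ []) ⟩
    u * u - + 4            ≡⟨ cong (_- + 4) u²≡4 ⟩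
    + 0                    ∎
    where open ≡-Reasoning
... | inj₁ u-2≡0 = inj₁ (i-j≡0⇒i≡j u (+ 2) u-2≡0)
... | inj₂ u+2≡0 = inj₂ (begin
  u                ≡⟨ solve (u ∷ []) ⟩
  (u + + 2) - + 2  ≡⟨ cong (_- + 2) u+2≡0 ⟩
  - + 2            ∎)
  where open ≡-Reasoning

i+j≡0⇒j≡-i : ∀ {i j} → i + j ≡ + 0 → j ≡ - i
i+j≡0⇒j≡-i {i} {j} i+j≡0 = begin
  j             ≡⟨ solve (i ∷ j ∷ []) ⟩
  (i + j) - i   ≡⟨ cong (_- i) i+j≡0 ⟩
  + 0 - i       ≡⟨ solve (i ∷ []) ⟩
  - i           ∎
  where open ≡-Reasoning

sign-unit : ℤ → ℤ
sign-unit (+ _)    = + 1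
sign-unit -[1+ _ ] = - + 1

+∣i∣≡sign-unit*i : ∀ i → + ∣ i ∣ ≡ sign-unit i * i
+∣i∣≡sign-unit*i (+ n)    = sym (*-identityˡ (+ n))
+∣i∣≡sign-unit*i -[1+ n ] = sym (-1*i≡-i -[1+ n ])

ℕ-identity⇒ℤ : ∀ d m n x y → d ℕ.+ y ℕ.* n ≡ x ℕ.* m → + d + + y * + n ≡ + x * + m
ℕ-identity⇒ℤ d m n x y eq = begin
  + d + + y * + n      ≡⟨ cong (_+_ (+ d)) (pos-* y n) ⟨
  + (d ℕ.+ y ℕ.* n)    ≡⟨ cong +_ eq ⟩
  + (x ℕ.* m)          ≡⟨ pos-* x m ⟩
  + x * + m            ∎
  where open ≡-Reasoning

isolate : ∀ {D M N} X Y → D + Y * N ≡ X * M → D ≡ X * M + (- Y) * N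
isolate {D} {M} {N} X Y eq = begin
  D                         ≡⟨ solve (D ∷ Y ∷ N ∷ []) ⟩
  (D + Y * N) + (- Y) * N   ≡⟨ cong (_+ (- Y) * N) eq ⟩
  X * M + (- Y) * N         ∎
  where open ≡-Reasoning

bézout-ℕ : ∀ {d m n} → Bézout.Identity d m n → ∃₂ λ α β → + d ≡ α * + m + β * + n
bézout-ℕ {d} {m} {n} (Bézout.+- x y eq) = + x , - + y , isolate (+ x) (+ y) (ℕ-identity⇒ℤ d m n x y eq)
bézout-ℕ {d} {m} {n} (Bézout.-+ x y eq) =
  - + x , + y , trans (isolate (+ y) (+ x) (ℕ-identity⇒ℤ d n m y x eq)) (+-comm (+ y * + n) (- + x * + m))

bézout : ∀ i j → ∃₂ λ α β → gcd i j ≡ α * i + β * j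
bézout i j with α , β , eq ← bézout-ℕ (Bézout.identity (gcd-GCD ∣ i ∣ ∣ j ∣)) =
  α * sign-unit i , β * sign-unit j , (begin
    gcd i j                                    ≡⟨ eq ⟩
    α * + ∣ i ∣ + β * + ∣ j ∣                    ≡⟨ cong₂ (λ m n → α * m + β * n) (+∣i∣≡sign-unit*i i) (+∣i∣≡sign-unit*i j) ⟩
    α * (sign-unit i * i) + β * (sign-unit j * j) ≡⟨ reassociate α β (sign-unit i) (sign-unit j) ⟩
    α * sign-unit i * i + β * sign-unit j * j  ∎)
  where
  open ≡-Reasoning
  reassociate : ∀ α β s t → α * (s * i) + β * (t * j) ≡ α * s * i + β * t * j
  reassociate α β s t = solve (α ∷ β ∷ s ∷ t ∷ i ∷ j ∷ [])

proportion-via-bézout : ∀ {g α β p q x y} → g ≡ α * p + β * q → p * x ≡ q * y →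
  g * x ≡ q * (α * y + β * x) × g * y ≡ p * (α * y + β * x)
proportion-via-bézout {g} {α} {β} {p} {q} {x} {y} refl px≡qy =
  (begin
    (α * p + β * q) * x     ≡⟨ solve vars ⟩
    α * (p * x) + β * q * x ≡⟨ cong (λ t → α * t + β * q * x) px≡qy ⟩
    α * (q * y) + β * q * x ≡⟨ solve vars ⟩
    q * (α * y + β * x)     ∎) ,
  (begin
    (α * p + β * q) * y     ≡⟨ solve vars ⟩
    α * p * y + β * (q * y) ≡⟨ cong (λ t → α * p * y + β * t) px≡qy ⟨
    α * p * y + β * (p * x) ≡⟨ solve vars ⟩
    p * (α * y + β * x)     ∎)
  where
  open ≡-Reasoning
  vars : List ℤ
  vars = α ∷ β ∷ p ∷ q ∷ x ∷ y ∷ []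

mat-≡ : ∀ {a a′ b b′ c c′ d d′} → a ≡ a′ → b ≡ b′ → c ≡ c′ → d ≡ d′ → mat a b c d ≡ mat a′ b′ c′ d′
mat-≡ refl refl refl refl = refl

O : M₂
O = mat (+ 0) (+ 0) (+ 0) (+ 0)

-- For X = (x₁ x₂; x₃ x₄) and Y = (y₁ y₂; y₃ y₄): E = (Eᵢⱼ) is X² + bY², K is XY − YX,
-- and u + ωv = det (X + ωY) when ω² = −b.  The definitions are INLINE so that the
-- ring solver sees polynomials in the entries.
module Entries (b x₁ x₂ x₃ x₄ y₁ y₂ y₃ y₄ : ℤ) where

  E₁₁ E₁₂ E₂₁ E₂₂ K₁₁ K₁₂ K₂₁ u v : ℤ
  E₁₁ = x₁ * x₁ + x₂ * x₃ + b * (y₁ * y₁ + y₂ * y₃)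
  E₁₂ = x₁ * x₂ + x₂ * x₄ + b * (y₁ * y₂ + y₂ * y₄)
  E₂₁ = x₃ * x₁ + x₄ * x₃ + b * (y₃ * y₁ + y₄ * y₃)
  E₂₂ = x₃ * x₂ + x₄ * x₄ + b * (y₃ * y₂ + y₄ * y₄)
  K₁₁ = x₂ * y₃ - y₂ * x₃
  K₁₂ = x₁ * y₂ + x₂ * y₄ - y₁ * x₂ - y₂ * x₄
  K₂₁ = x₃ * y₁ + x₄ * y₃ - y₃ * x₁ - y₄ * x₃
  u = x₁ * x₄ - x₂ * x₃ - b * (y₁ * y₄ - y₂ * y₃)
  v = x₁ * y₄ + x₄ * y₁ - x₂ * y₃ - x₃ * y₂
  {-# INLINE E₁₁ #-}
  {-# INLINE E₁₂ #-}
  {-# INLINE E₂₁ #-}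
  {-# INLINE E₂₂ #-}
  {-# INLINE K₁₁ #-}
  {-# INLINE K₁₂ #-}
  {-# INLINE K₂₁ #-}
  {-# INLINE u #-}
  {-# INLINE v #-}

  K : M₂
  K = mat K₁₁ K₁₂ K₂₁ (- K₁₁)

  vars : List ℤ
  vars = b ∷ x₁ ∷ x₂ ∷ x₃ ∷ x₄ ∷ y₁ ∷ y₂ ∷ y₃ ∷ y₄ ∷ []

  E₁₂-by-traces : E₁₂ ≡ x₂ * (x₁ + x₄) + b * (y₂ * (y₁ + y₄))
  E₁₂-by-traces = solve vars

  -- Entries of b (tr Y) K = XE − EX, which holds as E − (tr X) X − b (tr Y) Y is scalar.
  bSK₁₁ : b * (y₁ + y₄) * K₁₁ ≡ x₂ * E₂₁ - x₃ * E₁₂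
  bSK₁₁ = solve vars

  bSK₁₂ : b * (y₁ + y₄) * K₁₂ ≡ (x₁ - x₄) * E₁₂ - x₂ * (E₁₁ - E₂₂)
  bSK₁₂ = solve vars

  bSK₂₁ : b * (y₁ + y₄) * K₂₁ ≡ x₃ * (E₁₁ - E₂₂) - (x₁ - x₄) * E₂₁
  bSK₂₁ = solve vars

  -- With Z = X + ωY and Z̄ = X − ωY one has Z Z̄ = E − ωK.  The next identities are
  -- det Z · det Z̄ = det (Z Z̄) and four coefficients of det Z · Z̄ = adj Z · Z Z̄.
  norm-identity : u * u + v * v * b ≡ E₁₁ * E₂₂ - E₁₂ * E₂₁ + b * (K₁₁ * K₁₁ + K₁₂ * K₂₁)
  norm-identity = solve vars

  adjugate-identity₁ : u * x₁ + v * b * y₁ ≡ x₄ * E₁₁ + b * y₄ * K₁₁ - x₂ * E₂₁ - b * y₂ * K₂₁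
  adjugate-identity₁ = solve vars

  adjugate-identity₂ : v * x₁ - u * y₁ ≡ y₄ * E₁₁ - x₄ * K₁₁ - y₂ * E₂₁ + x₂ * K₂₁
  adjugate-identity₂ = solve vars

  adjugate-identity₃ : v * x₂ - u * y₂ ≡ y₄ * E₁₂ - x₄ * K₁₂ - y₂ * E₂₂ - x₂ * K₁₁
  adjugate-identity₃ = solve vars

  adjugate-identity₄ : v * x₃ - u * y₃ ≡ y₁ * E₂₁ - x₁ * K₂₁ - y₃ * E₁₁ + x₃ * K₁₁
  adjugate-identity₄ = solve vars

module Parametrisation (b u v g t₂ t₃ x₁ x₂ x₃ y₁ y₂ y₃ : ℤ)
  (norm : u * u + v * v * b ≡ + 4)
  (gx₂ : g * x₂ ≡ (u - + 2) * t₂) (gx₃ : g * x₃ ≡ (u - + 2) * t₃)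
  (gy₂ : g * y₂ ≡ v * t₂) (gy₃ : g * y₃ ≡ v * t₃) where
  open ≡-Reasoning

  -- C = 2g² is the condition of case (ii) with its denominators cleared.
  E₁₁ C : ℤ
  E₁₁ = x₁ * x₁ + x₂ * x₃ + b * (y₁ * y₁ + y₂ * y₃)
  C = g * g * (x₁ * x₁ + b * (y₁ * y₁)) + + 4 * t₂ * t₃ * (+ 2 - u)
  {-# INLINE E₁₁ #-}
  {-# INLINE C #-}

  vars : List ℤ
  vars = b ∷ u ∷ v ∷ g ∷ t₂ ∷ t₃ ∷ x₁ ∷ x₂ ∷ x₃ ∷ y₁ ∷ y₂ ∷ y₃ ∷ []

  g²E₁₁≡C : g * g * E₁₁ ≡ C
  g²E₁₁≡C = begin
    g * g * E₁₁                                                           ≡⟨ solve vars ⟩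
    g * g * (x₁ * x₁) + (g * x₂) * (g * x₃) + b * (g * g * (y₁ * y₁) + (g * y₂) * (g * y₃))
      ≡⟨ cong₂ (λ p q → g * g * (x₁ * x₁) + p + b * (g * g * (y₁ * y₁) + q)) (cong₂ _*_ gx₂ gx₃) (cong₂ _*_ gy₂ gy₃) ⟩
    g * g * (x₁ * x₁) + ((u - + 2) * t₂) * ((u - + 2) * t₃) + b * (g * g * (y₁ * y₁) + (v * t₂) * (v * t₃))
      ≡⟨ solve vars ⟩
    C + t₂ * t₃ * (u * u + v * v * b - + 4)                              ≡⟨ cong (λ n → C + t₂ * t₃ * (n - + 4)) norm ⟩
    C + t₂ * t₃ * (+ 4 - + 4)                                            ≡⟨ solve vars ⟩
    C                                                                    ∎

  condition : E₁₁ ≡ + 2 → C ≡ + 2 * (g * g)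
  condition E₁₁≡2 = begin
    C               ≡⟨ g²E₁₁≡C ⟨
    g * g * E₁₁     ≡⟨ cong (g * g *_) E₁₁≡2 ⟩
    g * g * + 2     ≡⟨ *-comm (g * g) (+ 2) ⟩
    + 2 * (g * g)   ∎

  solution : ∀ {x₄ y₄} → g ≢ + 0 → C ≡ + 2 * (g * g) →
    + 2 * x₄ ≡ u * x₁ + v * b * y₁ → + 2 * y₄ ≡ v * x₁ - u * y₁ →
    sq (mat x₁ x₂ x₃ x₄) ⊕ b · sq (mat y₁ y₂ y₃ y₄) ≡ (+ 2) · I
  solution {x₄} {y₄} g≢0 C≡2g² 2x₄ 2y₄ = mat-≡ e₁₁ e₁₂ e₂₁ e₂₂
    where
    instance
      g-nonZero : NonZero g
      g-nonZero = ≢-nonZero g≢0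
    vars′ : List ℤ
    vars′ = x₄ ∷ y₄ ∷ vars
    e₁₁ : E₁₁ ≡ + 2
    e₁₁ = *-cancelˡ-≡ (g * g) E₁₁ (+ 2) {{i*j≢0 g g}} (begin
      g * g * E₁₁     ≡⟨ g²E₁₁≡C ⟩
      C               ≡⟨ C≡2g² ⟩
      + 2 * (g * g)   ≡⟨ *-comm (+ 2) (g * g) ⟩
      g * g * + 2     ∎)
    e₁₂ : x₁ * x₂ + x₂ * x₄ + b * (y₁ * y₂ + y₂ * y₄) ≡ + 0
    e₁₂ = *-cancelˡ-≡ (+ 2 * g) _ _ {{i*j≢0 (+ 2) g}} (begin
      + 2 * g * (x₁ * x₂ + x₂ * x₄ + b * (y₁ * y₂ + y₂ * y₄))  ≡⟨ solve vars′ ⟩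
      (g * x₂) * (+ 2 * x₁ + + 2 * x₄) + b * ((g * y₂) * (+ 2 * y₁ + + 2 * y₄))
        ≡⟨ cong₂ (λ p q → p + b * q) (cong₂ (λ p q → p * (+ 2 * x₁ + q)) gx₂ 2x₄) (cong₂ (λ p q → p * (+ 2 * y₁ + q)) gy₂ 2y₄) ⟩
      ((u - + 2) * t₂) * (+ 2 * x₁ + (u * x₁ + v * b * y₁)) + b * ((v * t₂) * (+ 2 * y₁ + (v * x₁ - u * y₁)))
        ≡⟨ solve vars ⟩
      t₂ * x₁ * (u * u + v * v * b - + 4)    ≡⟨ cong (λ n → t₂ * x₁ * (n - + 4)) norm ⟩
      t₂ * x₁ * (+ 4 - + 4)                  ≡⟨ solve vars ⟩
      + 2 * g * + 0                          ∎)
    e₂₁ : x₃ * x₁ + x₄ * x₃ + b * (y₃ * y₁ + y₄ * y₃) ≡ + 0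
    e₂₁ = *-cancelˡ-≡ (+ 2 * g) _ _ {{i*j≢0 (+ 2) g}} (begin
      + 2 * g * (x₃ * x₁ + x₄ * x₃ + b * (y₃ * y₁ + y₄ * y₃))  ≡⟨ solve vars′ ⟩
      (g * x₃) * (+ 2 * x₁ + + 2 * x₄) + b * ((g * y₃) * (+ 2 * y₁ + + 2 * y₄))
        ≡⟨ cong₂ (λ p q → p + b * q) (cong₂ (λ p q → p * (+ 2 * x₁ + q)) gx₃ 2x₄) (cong₂ (λ p q → p * (+ 2 * y₁ + q)) gy₃ 2y₄) ⟩
      ((u - + 2) * t₃) * (+ 2 * x₁ + (u * x₁ + v * b * y₁)) + b * ((v * t₃) * (+ 2 * y₁ + (v * x₁ - u * y₁)))
        ≡⟨ solve vars ⟩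
      t₃ * x₁ * (u * u + v * v * b - + 4)    ≡⟨ cong (λ n → t₃ * x₁ * (n - + 4)) norm ⟩
      t₃ * x₁ * (+ 4 - + 4)                  ≡⟨ solve vars ⟩
      + 2 * g * + 0                          ∎)
    e₂₂ : x₃ * x₂ + x₄ * x₄ + b * (y₃ * y₂ + y₄ * y₄) ≡ + 2
    e₂₂ = *-cancelˡ-≡ (+ 4 * (g * g)) _ _ {{i*j≢0 (+ 4) (g * g) {{_}} {{i*j≢0 g g}}}} (begin
      + 4 * (g * g) * (x₃ * x₂ + x₄ * x₄ + b * (y₃ * y₂ + y₄ * y₄))  ≡⟨ solve vars′ ⟩
      (+ 4 * ((g * x₃) * (g * x₂)) + g * g * ((+ 2 * x₄) * (+ 2 * x₄)))
        + b * (+ 4 * ((g * y₃) * (g * y₂)) + g * g * ((+ 2 * y₄) * (+ 2 * y₄)))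
        ≡⟨ cong₂ (λ p q → p + b * q)
             (cong₂ (λ p q → + 4 * p + g * g * (q * q)) (cong₂ _*_ gx₃ gx₂) 2x₄)
             (cong₂ (λ p q → + 4 * p + g * g * (q * q)) (cong₂ _*_ gy₃ gy₂) 2y₄) ⟩
      (+ 4 * (((u - + 2) * t₃) * ((u - + 2) * t₂)) + g * g * ((u * x₁ + v * b * y₁) * (u * x₁ + v * b * y₁)))
        + b * (+ 4 * ((v * t₃) * (v * t₂)) + g * g * ((v * x₁ - u * y₁) * (v * x₁ - u * y₁)))
        ≡⟨ solve vars ⟩
      + 4 * C + (u * u + v * v * b - + 4) * (+ 4 * t₂ * t₃ + g * g * (x₁ * x₁ + b * (y₁ * y₁)))
        ≡⟨ cong₂ (λ c n → + 4 * c + (n - + 4) * (+ 4 * t₂ * t₃ + g * g * (x₁ * x₁ + b * (y₁ * y₁)))) C≡2g² norm ⟩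
      + 4 * (+ 2 * (g * g)) + (+ 4 - + 4) * (+ 4 * t₂ * t₃ + g * g * (x₁ * x₁ + b * (y₁ * y₁)))
        ≡⟨ solve vars ⟩
      + 4 * (g * g) * + 2                    ∎)

module Relations (b u v x₁ x₂ x₃ x₄ y₁ y₂ y₃ y₄ : ℤ)
  (e₁₁ : x₁ * x₁ + x₂ * x₃ + b * (y₁ * y₁ + y₂ * y₃) ≡ + 2)
  (norm : u * u + v * v * b ≡ + 4)
  (2x₄≡ux₁+vby₁ : + 2 * x₄ ≡ u * x₁ + v * b * y₁) (2y₄≡vx₁-uy₁ : + 2 * y₄ ≡ v * x₁ - u * y₁)
  (vx₂≡[u-2]y₂ : v * x₂ ≡ (u - + 2) * y₂) (vx₃≡[u-2]y₃ : v * x₃ ≡ (u - + 2) * y₃) where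
  open ≡-Reasoning

  private
    X Y : M₂
    X = mat x₁ x₂ x₃ x₄
    Y = mat y₁ y₂ y₃ y₄

  u≡2⇒v≡0 : b ≢ + 0 → u ≡ + 2 → v ≡ + 0
  u≡2⇒v≡0 b≢0 refl = reduce (i*j≡0⇒i≡0∨j≡0 v (*-cancelʳ-≡ (v * v) (+ 0) b {{≢-nonZero b≢0}} (begin
    v * v * b                       ≡⟨ solve (b ∷ v ∷ []) ⟩
    (+ 2 * + 2 + v * v * b) - + 4   ≡⟨ cong (_- + 4) norm ⟩
    + 4 - + 4                       ≡⟨ solve (b ∷ []) ⟩
    + 0 * b                         ∎)))

  v≡0⇒u≡2⇒trY≡0 : v ≡ + 0 → u ≡ + 2 → y₁ + y₄ ≡ + 0
  v≡0⇒u≡2⇒trY≡0 refl refl = *-cancelˡ-≡ (+ 2) (y₁ + y₄) (+ 0) (begin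
    + 2 * (y₁ + y₄)                    ≡⟨ solve (y₁ ∷ y₄ ∷ []) ⟩
    + 2 * y₁ + + 2 * y₄                ≡⟨ cong (_+_ (+ 2 * y₁)) 2y₄≡vx₁-uy₁ ⟩
    + 2 * y₁ + (+ 0 * x₁ - + 2 * y₁)   ≡⟨ solve (x₁ ∷ y₁ ∷ []) ⟩
    + 2 * + 0                          ∎)

  u≡2⇒trY≡0 : b ≢ + 0 → u ≡ + 2 → y₁ + y₄ ≡ + 0
  u≡2⇒trY≡0 b≢0 u≡2 = v≡0⇒u≡2⇒trY≡0 (u≡2⇒v≡0 b≢0 u≡2) u≡2

  v≡0⇒u²≡4 : v ≡ + 0 → u * u ≡ + 4
  v≡0⇒u²≡4 refl = begin
    u * u                      ≡⟨ solve (u ∷ b ∷ []) ⟩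
    u * u + + 0 * + 0 * b      ≡⟨ norm ⟩
    + 4                        ∎

  caseIIpos : v ≡ + 0 → u ≡ - + 2 → CaseIIpos b X Y
  caseIIpos refl refl = x₁ , x₂ , x₃ , y₁ , cong (mat x₁ x₂ x₃) x₄≡-x₁ , mat-≡ y₁≡y₁1 y₂≡y₁0 y₃≡y₁0 y₄≡y₁1 , (begin
    x₁ * x₁ + x₂ * x₃ + b * (y₁ * y₁)             ≡⟨ solve (b ∷ x₁ ∷ x₂ ∷ x₃ ∷ y₁ ∷ y₃ ∷ []) ⟩
    x₁ * x₁ + x₂ * x₃ + b * (y₁ * y₁ + + 0 * y₃)  ≡⟨ cong (λ t → x₁ * x₁ + x₂ * x₃ + b * (y₁ * y₁ + t * y₃)) y₂≡0 ⟨
    x₁ * x₁ + x₂ * x₃ + b * (y₁ * y₁ + y₂ * y₃)   ≡⟨ e₁₁ ⟩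
    + 2                                           ∎)
    where
    x₄≡-x₁ : x₄ ≡ - x₁
    x₄≡-x₁ = *-cancelˡ-≡ (+ 2) x₄ (- x₁) (begin
      + 2 * x₄                           ≡⟨ 2x₄≡ux₁+vby₁ ⟩
      (- + 2) * x₁ + + 0 * b * y₁        ≡⟨ solve (b ∷ x₁ ∷ y₁ ∷ []) ⟩
      + 2 * (- x₁)                       ∎)
    0≡-4y⇒y≡0 : ∀ x y → + 0 * x ≡ (- + 2 - + 2) * y → y ≡ + 0
    0≡-4y⇒y≡0 x y eq = *-cancelˡ-≡ (- + 4) y (+ 0) (begin
      (- + 4) * y             ≡⟨ solve (x ∷ y ∷ []) ⟩
      (- + 2 - + 2) * y       ≡⟨ eq ⟨
      + 0 * x                 ≡⟨ solve (x ∷ y ∷ []) ⟩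
      (- + 4) * + 0           ∎)
    y₂≡0 : y₂ ≡ + 0
    y₂≡0 = 0≡-4y⇒y≡0 x₂ y₂ vx₂≡[u-2]y₂
    y₁≡y₁1 : y₁ ≡ y₁ * + 1
    y₁≡y₁1 = sym (*-identityʳ y₁)
    y₂≡y₁0 : y₂ ≡ y₁ * + 0
    y₂≡y₁0 = trans y₂≡0 (sym (*-zeroʳ y₁))
    y₃≡y₁0 : y₃ ≡ y₁ * + 0
    y₃≡y₁0 = trans (0≡-4y⇒y≡0 x₃ y₃ vx₃≡[u-2]y₃) (sym (*-zeroʳ y₁))
    y₄≡y₁1 : y₄ ≡ y₁ * + 1
    y₄≡y₁1 = *-cancelˡ-≡ (+ 2) y₄ (y₁ * + 1) (begin
      + 2 * y₄                   ≡⟨ 2y₄≡vx₁-uy₁ ⟩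
      + 0 * x₁ - (- + 2) * y₁    ≡⟨ solve (x₁ ∷ y₁ ∷ []) ⟩
      + 2 * (y₁ * + 1)           ∎)

  b>0⇒caseIIpos : b > + 0 → b ≢ + 3 → HasPrimeDivisor3or5mod8 b → y₁ + y₄ ≢ + 0 → CaseIIpos b X Y
  b>0⇒caseIIpos b>0 b≢3 b-divisor trY≢0 with v≡0 ← u²+v²b≡4⇒v≡0 b>0 b≢3 b-divisor u v norm
    with u*u≡4⇒u≡±2 u (v≡0⇒u²≡4 v≡0)
  ... | inj₁ u≡2  = contradiction (v≡0⇒u≡2⇒trY≡0 v≡0 u≡2) trY≢0
  ... | inj₂ u≡-2 = caseIIpos v≡0 u≡-2

  caseIIneg : u ≢ + 2 → CaseIIneg b X Y
  caseIIneg u≢2 = parametrise (bézout v (u - + 2))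
    where
    parametrise : ∃₂ (λ α β → gcd v (u - + 2) ≡ α * v + β * (u - + 2)) → CaseIIneg b X Y
    parametrise (α , β , g≡) =
      x₁ , t₂ , t₃ , y₁ , u , v , u≢2 , norm ,
      Parametrisation.condition b u v g t₂ t₃ x₁ x₂ x₃ y₁ y₂ y₃ norm gx₂ gx₃ gy₂ gy₃ e₁₁ ,
      refl , gx₂ , gx₃ , 2x₄≡ux₁+vby₁ , refl , gy₂ , gy₃ , 2y₄≡vx₁-uy₁
      where
      g t₂ t₃ : ℤ
      g = gcd v (u - + 2)
      t₂ = α * y₂ + β * x₂
      t₃ = α * y₃ + β * x₃
      scaled : ∀ x y → v * x ≡ (u - + 2) * y →
               g * x ≡ (u - + 2) * (α * y + β * x) × g * y ≡ v * (α * y + β * x)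
      scaled x y = proportion-via-bézout {g} {α} {β} {v} {u - + 2} {x} {y} g≡
      gx₂ : g * x₂ ≡ (u - + 2) * t₂
      gx₂ = proj₁ (scaled x₂ y₂ vx₂≡[u-2]y₂)
      gy₂ : g * y₂ ≡ v * t₂
      gy₂ = proj₂ (scaled x₂ y₂ vx₂≡[u-2]y₂)
      gx₃ : g * x₃ ≡ (u - + 2) * t₃
      gx₃ = proj₁ (scaled x₃ y₃ vx₃≡[u-2]y₃)
      gy₃ : g * y₃ ≡ v * t₃
      gy₃ = proj₂ (scaled x₃ y₃ vx₃≡[u-2]y₃)

  trY≢0⇒caseIIneg : b ≢ + 0 → y₁ + y₄ ≢ + 0 → CaseIIneg b X Y
  trY≢0⇒caseIIneg b≢0 trY≢0 = caseIIneg (trY≢0 ∘ u≡2⇒trY≡0 b≢0)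

module Solution (b x₁ x₂ x₃ x₄ y₁ y₂ y₃ y₄ : ℤ)
  (sol : sq (mat x₁ x₂ x₃ x₄) ⊕ b · sq (mat y₁ y₂ y₃ y₄) ≡ (+ 2) · I) where
  open Entries b x₁ x₂ x₃ x₄ y₁ y₂ y₃ y₄
  open ≡-Reasoning

  private
    X Y : M₂
    X = mat x₁ x₂ x₃ x₄
    Y = mat y₁ y₂ y₃ y₄

  e₁₁ : E₁₁ ≡ + 2
  e₁₁ = cong a₁₁ sol
  e₁₂ : E₁₂ ≡ + 0
  e₁₂ = cong a₁₂ sol
  e₂₁ : E₂₁ ≡ + 0
  e₂₁ = cong a₂₁ sol
  e₂₂ : E₂₂ ≡ + 2
  e₂₂ = cong a₂₂ sol

  traceless : x₁ + x₄ ≡ + 0 → y₁ + y₄ ≡ + 0 → CaseI b X Y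
  traceless trX≡0 trY≡0 =
    x₁ , x₂ , x₃ , y₁ , y₂ , y₃ , cong (mat x₁ x₂ x₃) (i+j≡0⇒j≡-i trX≡0) , cong (mat y₁ y₂ y₃) (i+j≡0⇒j≡-i trY≡0) , e₁₁

  trY≡0⇒trX≡0 : HasPrimeDivisor3or5mod8 b → y₁ + y₄ ≡ + 0 → x₁ + x₄ ≡ + 0
  trY≡0⇒trX≡0 b-divisor trY≡0 with x₁ + x₄ ≟ + 0
  ... | yes trX≡0 = trX≡0
  ... | no trX≢0  = contradiction x₁²+bk≡2 (x²+bk≢2 {b} b-divisor x₁ (y₁ * y₁ + y₂ * y₃))
    where
    x₂≡0 : x₂ ≡ + 0
    x₂≡0 = *-cancelʳ-≡ x₂ (+ 0) (x₁ + x₄) {{≢-nonZero trX≢0}} (begin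
      x₂ * (x₁ + x₄)                          ≡⟨ solve vars ⟩
      x₂ * (x₁ + x₄) + b * (y₂ * + 0)         ≡⟨ cong (λ S → x₂ * (x₁ + x₄) + b * (y₂ * S)) trY≡0 ⟨
      x₂ * (x₁ + x₄) + b * (y₂ * (y₁ + y₄))   ≡⟨ E₁₂-by-traces ⟨
      E₁₂                                     ≡⟨ e₁₂ ⟩
      + 0                                     ≡⟨ solve vars ⟩
      + 0 * (x₁ + x₄)                         ∎)
    x₁²+bk≡2 : x₁ * x₁ + b * (y₁ * y₁ + y₂ * y₃) ≡ + 2
    x₁²+bk≡2 = begin
      x₁ * x₁ + b * (y₁ * y₁ + y₂ * y₃)             ≡⟨ solve vars ⟩
      x₁ * x₁ + + 0 * x₃ + b * (y₁ * y₁ + y₂ * y₃)  ≡⟨ cong (λ t → x₁ * x₁ + t * x₃ + b * (y₁ * y₁ + y₂ * y₃)) x₂≡0 ⟨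
      E₁₁                                           ≡⟨ e₁₁ ⟩
      + 2                                           ∎

  commute : b * (y₁ + y₄) ≢ + 0 → K ≡ O
  commute bS≢0 = mat-≡ K₁₁≡0 K₁₂≡0 K₂₁≡0 (cong -_ K₁₁≡0)
    where
    cancel : ∀ k → b * (y₁ + y₄) * k ≡ + 0 → k ≡ + 0
    cancel k eq = *-cancelˡ-≡ (b * (y₁ + y₄)) k (+ 0) {{≢-nonZero bS≢0}} (trans eq (sym (*-zeroʳ (b * (y₁ + y₄)))))
    K₁₁≡0 : K₁₁ ≡ + 0
    K₁₁≡0 = cancel K₁₁ (begin
      b * (y₁ + y₄) * K₁₁         ≡⟨ bSK₁₁ ⟩
      x₂ * E₂₁ - x₃ * E₁₂         ≡⟨ cong₂ (λ p q → x₂ * p - x₃ * q) e₂₁ e₁₂ ⟩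
      x₂ * + 0 - x₃ * + 0         ≡⟨ solve vars ⟩
      + 0                         ∎)
    K₁₂≡0 : K₁₂ ≡ + 0
    K₁₂≡0 = cancel K₁₂ (begin
      b * (y₁ + y₄) * K₁₂                    ≡⟨ bSK₁₂ ⟩
      (x₁ - x₄) * E₁₂ - x₂ * (E₁₁ - E₂₂)     ≡⟨ cong₂ (λ p q → (x₁ - x₄) * p - x₂ * q) e₁₂ (cong₂ _-_ e₁₁ e₂₂) ⟩
      (x₁ - x₄) * + 0 - x₂ * (+ 2 - + 2)     ≡⟨ solve vars ⟩
      + 0                                    ∎)
    K₂₁≡0 : K₂₁ ≡ + 0
    K₂₁≡0 = cancel K₂₁ (begin
      b * (y₁ + y₄) * K₂₁                    ≡⟨ bSK₂₁ ⟩
      x₃ * (E₁₁ - E₂₂) - (x₁ - x₄) * E₂₁     ≡⟨ cong₂ (λ p q → x₃ * p - (x₁ - x₄) * q) (cong₂ _-_ e₁₁ e₂₂) e₂₁ ⟩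
      x₃ * (+ 2 - + 2) - (x₁ - x₄) * + 0     ≡⟨ solve vars ⟩
      + 0                                    ∎)

  module _ (comm : K ≡ O) where

    norm : u * u + v * v * b ≡ + 4
    norm = begin
      u * u + v * v * b                                        ≡⟨ norm-identity ⟩
      E₁₁ * E₂₂ - E₁₂ * E₂₁ + b * (K₁₁ * K₁₁ + K₁₂ * K₂₁)
        ≡⟨ cong₂ (λ E C → a₁₁ E * a₂₂ E - a₁₂ E * a₂₁ E + b * (a₁₁ C * a₁₁ C + a₁₂ C * a₂₁ C)) sol comm ⟩
      + 2 * + 2 - + 0 * + 0 + b * (+ 0 * + 0 + + 0 * + 0)      ≡⟨ solve vars ⟩
      + 4                                                      ∎

    2x₄≡ux₁+vby₁ : + 2 * x₄ ≡ u * x₁ + v * b * y₁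
    2x₄≡ux₁+vby₁ = begin
      + 2 * x₄                                              ≡⟨ solve vars ⟩
      x₄ * + 2 + b * y₄ * + 0 - x₂ * + 0 - b * y₂ * + 0
        ≡⟨ cong₂ (λ E C → x₄ * a₁₁ E + b * y₄ * a₁₁ C - x₂ * a₂₁ E - b * y₂ * a₂₁ C) sol comm ⟨
      x₄ * E₁₁ + b * y₄ * K₁₁ - x₂ * E₂₁ - b * y₂ * K₂₁      ≡⟨ adjugate-identity₁ ⟨
      u * x₁ + v * b * y₁                                   ∎

    2y₄≡vx₁-uy₁ : + 2 * y₄ ≡ v * x₁ - u * y₁
    2y₄≡vx₁-uy₁ = begin
      + 2 * y₄                                              ≡⟨ solve vars ⟩
      y₄ * + 2 - x₄ * + 0 - y₂ * + 0 + x₂ * + 0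
        ≡⟨ cong₂ (λ E C → y₄ * a₁₁ E - x₄ * a₁₁ C - y₂ * a₂₁ E + x₂ * a₂₁ C) sol comm ⟨
      y₄ * E₁₁ - x₄ * K₁₁ - y₂ * E₂₁ + x₂ * K₂₁             ≡⟨ adjugate-identity₂ ⟨
      v * x₁ - u * y₁                                       ∎

    vx₂≡[u-2]y₂ : v * x₂ ≡ (u - + 2) * y₂
    vx₂≡[u-2]y₂ = begin
      v * x₂                                                ≡⟨ solve vars ⟩
      (v * x₂ - u * y₂) + u * y₂                            ≡⟨ cong (_+ u * y₂) adjugate-identity₃ ⟩
      (y₄ * E₁₂ - x₄ * K₁₂ - y₂ * E₂₂ - x₂ * K₁₁) + u * y₂
        ≡⟨ cong₂ (λ E C → (y₄ * a₁₂ E - x₄ * a₁₂ C - y₂ * a₂₂ E - x₂ * a₁₁ C) + u * y₂) sol comm ⟩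
      (y₄ * + 0 - x₄ * + 0 - y₂ * + 2 - x₂ * + 0) + u * y₂  ≡⟨ solve vars ⟩
      (u - + 2) * y₂                                        ∎

    vx₃≡[u-2]y₃ : v * x₃ ≡ (u - + 2) * y₃
    vx₃≡[u-2]y₃ = begin
      v * x₃                                                ≡⟨ solve vars ⟩
      (v * x₃ - u * y₃) + u * y₃                            ≡⟨ cong (_+ u * y₃) adjugate-identity₄ ⟩
      (y₁ * E₂₁ - x₁ * K₂₁ - y₃ * E₁₁ + x₃ * K₁₁) + u * y₃
        ≡⟨ cong₂ (λ E C → (y₁ * a₂₁ E - x₁ * a₂₁ C - y₃ * a₁₁ E + x₃ * a₁₁ C) + u * y₃) sol comm ⟩
      (y₁ * + 0 - x₁ * + 0 - y₃ * + 2 + x₃ * + 0) + u * y₃  ≡⟨ solve vars ⟩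
      (u - + 2) * y₃                                        ∎

  module Commuting (comm : K ≡ O) = Relations b u v x₁ x₂ x₃ x₄ y₁ y₂ y₃ y₄ e₁₁ (norm comm)
    (2x₄≡ux₁+vby₁ comm) (2y₄≡vx₁-uy₁ comm) (vx₂≡[u-2]y₂ comm) (vx₃≡[u-2]y₃ comm)

caseI-sound : ∀ {b X Y} → CaseI b X Y → sq X ⊕ b · sq Y ≡ (+ 2) · I
caseI-sound {b} (t₁ , t₂ , t₃ , s₁ , s₂ , s₃ , refl , refl , E₁₁≡2) = mat-≡ E₁₁≡2 E₁₂≡0 E₂₁≡0 (trans E₂₂≡E₁₁ E₁₁≡2)
  where
  vars : List ℤ
  vars = b ∷ t₁ ∷ t₂ ∷ t₃ ∷ s₁ ∷ s₂ ∷ s₃ ∷ []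
  E₁₂≡0 : t₁ * t₂ + t₂ * (- t₁) + b * (s₁ * s₂ + s₂ * (- s₁)) ≡ + 0
  E₁₂≡0 = solve vars
  E₂₁≡0 : t₃ * t₁ + (- t₁) * t₃ + b * (s₃ * s₁ + (- s₁) * s₃) ≡ + 0
  E₂₁≡0 = solve vars
  E₂₂≡E₁₁ : t₃ * t₂ + (- t₁) * (- t₁) + b * (s₃ * s₂ + (- s₁) * (- s₁)) ≡ t₁ * t₁ + t₂ * t₃ + b * (s₁ * s₁ + s₂ * s₃)
  E₂₂≡E₁₁ = solve vars

caseIIpos-sound : ∀ {b X Y} → CaseIIpos b X Y → sq X ⊕ b · sq Y ≡ (+ 2) · I
caseIIpos-sound {b} (t₁ , t₂ , t₃ , t₄ , refl , refl , condition) =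
  mat-≡ (trans E₁₁≡ condition) E₁₂≡0 E₂₁≡0 (trans E₂₂≡ condition)
  where
  vars : List ℤ
  vars = b ∷ t₁ ∷ t₂ ∷ t₃ ∷ t₄ ∷ []
  E₁₁≡ : t₁ * t₁ + t₂ * t₃ + b * (t₄ * + 1 * (t₄ * + 1) + t₄ * + 0 * (t₄ * + 0)) ≡ t₁ * t₁ + t₂ * t₃ + b * (t₄ * t₄)
  E₁₁≡ = solve vars
  E₁₂≡0 : t₁ * t₂ + t₂ * (- t₁) + b * (t₄ * + 1 * (t₄ * + 0) + t₄ * + 0 * (t₄ * + 1)) ≡ + 0
  E₁₂≡0 = solve vars
  E₂₁≡0 : t₃ * t₁ + (- t₁) * t₃ + b * (t₄ * + 0 * (t₄ * + 1) + t₄ * + 1 * (t₄ * + 0)) ≡ + 0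
  E₂₁≡0 = solve vars
  E₂₂≡ : t₃ * t₂ + (- t₁) * (- t₁) + b * (t₄ * + 0 * (t₄ * + 0) + t₄ * + 1 * (t₄ * + 1)) ≡ t₁ * t₁ + t₂ * t₃ + b * (t₄ * t₄)
  E₂₂≡ = solve vars

caseIIneg-sound : ∀ {b X Y} → CaseIIneg b X Y → sq X ⊕ b · sq Y ≡ (+ 2) · I
caseIIneg-sound {b} {mat x₁ x₂ x₃ x₄} {mat y₁ y₂ y₃ y₄}
  (_ , t₂ , t₃ , _ , u , v , u≢2 , norm , condition , refl , gx₂ , gx₃ , 2x₄ , refl , gy₂ , gy₃ , 2y₄) =
  Parametrisation.solution b u v g t₂ t₃ x₁ x₂ x₃ y₁ y₂ y₃ norm gx₂ gx₃ gy₂ gy₃ g≢0 condition 2x₄ 2y₄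
  where
  g : ℤ
  g = gcd v (u - + 2)
  g≢0 : g ≢ + 0
  g≢0 = u≢2 ∘ i-j≡0⇒i≡j u (+ 2) ∘ gcd[i,j]≡0⇒j≡0 {v}

proposition4p4 : (b : ℤ) → b ≢ + 0 → b ≢ + 3 → ¬ IsPerfectSquare (- b) →
    HasPrimeDivisor3or5mod8 b →
    (X Y : M₂) →
    ((sq X ⊕ (b · sq Y)) ≡ ((+ 2) · I)) ⇔ (CaseI b X Y ⊎ CaseII b X Y)
proposition4p4 b b≢0 b≢3 _ b-divisor X@(mat x₁ x₂ x₃ x₄) Y@(mat y₁ y₂ y₃ y₄) = mk⇔ forward backward
  where
  backward : CaseI b X Y ⊎ CaseII b X Y → sq X ⊕ b · sq Y ≡ (+ 2) · I
  backward (inj₁ i)               = caseI-sound {b} i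
  backward (inj₂ (inj₁ (_ , ii))) = caseIIpos-sound {b} ii
  backward (inj₂ (inj₂ (_ , ii))) = caseIIneg-sound {b} ii

  forward : sq X ⊕ b · sq Y ≡ (+ 2) · I → CaseI b X Y ⊎ CaseII b X Y
  forward sol with y₁ + y₄ ≟ + 0 | <-cmp b (+ 0)
  ... | yes trY≡0 | _ = inj₁ (traceless (trY≡0⇒trX≡0 b-divisor trY≡0) trY≡0)
    where open Solution b x₁ x₂ x₃ x₄ y₁ y₂ y₃ y₄ sol
  ... | no _ | tri≈ _ b≡0 _ = contradiction b≡0 b≢0
  ... | no trY≢0 | tri< b<0 _ _ = inj₂ (inj₂ (b<0 , trY≢0⇒caseIIneg b≢0 trY≢0))
    where
    open Solution b x₁ x₂ x₃ x₄ y₁ y₂ y₃ y₄ sol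
    open Commuting (commute ([ b≢0 , trY≢0 ]′ ∘ i*j≡0⇒i≡0∨j≡0 b))
  ... | no trY≢0 | tri> _ _ b>0 = inj₂ (inj₁ (b>0 , b>0⇒caseIIpos b>0 b≢3 b-divisor trY≢0))
    where
    open Solution b x₁ x₂ x₃ x₄ y₁ y₂ y₃ y₄ sol
    open Commuting (commute ([ b≢0 , trY≢0 ]′ ∘ i*j≡0⇒i≡0∨j≡0 b))
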